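{- If $G$ is a tree that is prime, then $G$ is total prime.
   Context: All graphs are finite and simple. A prime labeling of a graph of order $n$ is a bijection from its vertex set to $\{1,\ldots,n\}$ such that labels of adjacent vertices are relatively prime; a graph is prime if it has one. For a graph $G$ with vertex set $V$ and edge set $E$, a total prime labeling is a bijection $\ell: V\cup E\to\{1,2,\ldots,|V|+|E|\}$ such that (i) for every pair of adjacent vertices $u,v$, $\gcd(\ell(u),\ell(v))=1$, and (ii) for every vertex $v$ of degree at least 2, the greatest common divisor of the labels $\ell(uv)$ over all edges $uv$ incident to $v$ equals 1. A graph is total prime if it admits a total prime labeling. -}

module Defs where

open import Data.Nat using (ℕ; zero; suc; _+_; _≤_)
open import Data.Nat.GCD using (gcd)
open import Data.Nat.Coprimality using (Coprime)
open import Data.Fin using (Fin; toℕ)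
open import Data.Fin.Properties using (_≟_)
open import Data.Product using (_×_; _,_; proj₁; proj₂; Σ; ∃; ∃-syntax)
open import Data.Sum using (_⊎_; inj₁; inj₂)
open import Data.List using (List; []; _∷_; length; filter; foldr; map)
open import Data.List.Base using (lookup)
open import Data.List.Relation.Unary.AllPairs using (AllPairs)
open import Data.List.Relation.Unary.Linked using (Linked)
open import Data.List.Relation.Unary.Any using (Any)
open import Data.Vec.Functional using ()
open import Data.Fin.Base using ()
open import Data.List.Base using (allFin; head; last)
open import Data.Maybe using (Maybe; just)
open import Relation.Binary.PropositionalEquality using (_≡_; _≢_)
open import Relation.Nullary using (¬_)
open import Relation.Nullary.Decidable using (_⊎-dec_)
open import Function.Bundles using (_⤖_; Bijection)
open import Function.Definitions using ()

-- Edge e joins the two vertices endpoints e; no loops, no parallel edges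
-- (edges are unordered pairs, so {u,v} and {v,u} are identified).
record Graph : Set where
  field
    n        : ℕ
    m        : ℕ
    ends     : Fin m → Fin n × Fin n
    noLoop   : ∀ e → proj₁ (ends e) ≢ proj₂ (ends e)
    noMulti  : ∀ e f → (ends e ≡ ends f ⊎ ends e ≡ (proj₂ (ends f) , proj₁ (ends f))) → e ≡ f

open Graph public

Incident : (G : Graph) → Fin (m G) → Fin (n G) → Set
Incident G e v = proj₁ (ends G e) ≡ v ⊎ proj₂ (ends G e) ≡ v

Adj : (G : Graph) → Fin (n G) → Fin (n G) → Set
Adj G u v = ∃[ e ] (ends G e ≡ (u , v) ⊎ ends G e ≡ (v , u))

incidentEdges : (G : Graph) → Fin (n G) → List (Fin (m G))
incidentEdges G v =
  filter (λ e → (proj₁ (ends G e) ≟ v) ⊎-dec (proj₂ (ends G e) ≟ v)) (allFin (m G))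

degree : (G : Graph) → Fin (n G) → ℕ
degree G v = length (incidentEdges G v)

record Walk (G : Graph) (u v : Fin (n G)) : Set where
  field
    verts   : List (Fin (n G))
    start   : head verts ≡ just u
    finish  : last verts ≡ just v
    steps   : Linked (Adj G) verts

Connected : Graph → Set
Connected G = ∀ u v → Walk G u v

record Cycle (G : Graph) : Set where
  field
    verts    : List (Fin (n G))
    long     : 3 ≤ length verts
    distinct : AllPairs _≢_ verts
    steps    : Linked (Adj G) verts
    first    : Fin (n G)
    lastV    : Fin (n G)
    isFirst  : head verts ≡ just first
    isLast   : last verts ≡ just lastV
    closes   : Adj G lastV first

Acyclic : Graph → Set
Acyclic G = ¬ Cycle G

IsTree : Graph → Set
IsTree G = (1 ≤ n G) × Connected G × Acyclic G

-- prime labeling: bijection V → {1,…,n}, realised as vertex v ↦ 1 + toℕ (f v)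
IsPrimeLabeling : (G : Graph) → (Fin (n G) ⤖ Fin (n G)) → Set
IsPrimeLabeling G f =
  ∀ u v → Adj G u v →
    Coprime (suc (toℕ (Bijection.to f u))) (suc (toℕ (Bijection.to f v)))

IsPrime : Graph → Set
IsPrime G = Σ (Fin (n G) ⤖ Fin (n G)) (IsPrimeLabeling G)

-- total prime labeling: bijection V ⊎ E → {1,…,n+m}, x ↦ 1 + toℕ (f x)
module _ (G : Graph) (f : (Fin (n G) ⊎ Fin (m G)) ⤖ Fin (n G + m G)) where
  labelV : Fin (n G) → ℕ
  labelV v = suc (toℕ (Bijection.to f (inj₁ v)))

  labelE : Fin (m G) → ℕ
  labelE e = suc (toℕ (Bijection.to f (inj₂ e)))

  incidentGcd : Fin (n G) → ℕ
  incidentGcd v = foldr gcd 0 (map labelE (incidentEdges G v))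

  IsTotalPrimeLabeling : Set
  IsTotalPrimeLabeling =
    (∀ u v → Adj G u v → Coprime (labelV u) (labelV v)) ×
    (∀ v → 2 ≤ degree G v → incidentGcd v ≡ 1)

IsTotalPrime : Graph → Set
IsTotalPrime G =
  Σ ((Fin (n G) ⊎ Fin (m G)) ⤖ Fin (n G + m G)) (IsTotalPrimeLabeling G)

{-# OPTIONS --safe #-}
module Submission where

-- Keep the prime labeling on the vertices (labels 1, …, n) and give the edges the
-- labels n + 1, …, n + m in an order in which every vertex of degree at least 2 has
-- two incident edges in consecutive positions: the gcd at such a vertex divides two
-- consecutive numbers, so it is 1. Such an order exists in every forest. Remove a
-- pendant edge e = vu (one exists, since a maximal path cannot be extended without
-- closing a cycle), order the other edges by induction, and insert e right next to
-- an edge e' = uw, on the side that does not separate e' from a neighbour it shares w with.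

open import Defs
open import Data.Nat using (zero; suc; _+_; _≤_; _<_; s≤s; z≤n)
open import Data.Nat.Properties using (+-comm; +-suc; <⇒≱; m<m+n; suc-injective)
open import Data.Nat.GCD using (gcd; gcd[m,n]∣m; gcd[m,n]∣n)
open import Data.Nat.Divisibility using (_∣_; ∣-trans; ∣1⇒≡1; ∣m+n∣m⇒∣n)
open import Data.Nat.Coprimality using (Coprime)
open import Data.Fin using (Fin; zero; suc; toℕ)
open import Data.Fin.Properties using (_≟_; +↔⊎; toℕ-↑ˡ; toℕ-↑ʳ; injective⇒≤)
open import Data.Product using (_×_; _,_; proj₁; proj₂; Σ; ∃; ∃₂; swap)
open import Data.Sum using (_⊎_; inj₁; inj₂; reduce)
import Data.Sum as Sum
open import Data.Sum.Function.Propositional using (_⊎-⤖_)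
open import Data.List
  using (List; []; _∷_; _++_; [_]; _∷ʳ_; length; foldr; allFin; last; lookup)
open import Data.List.Properties using (++-assoc; length-tabulate)
open import Data.List.Relation.Unary.Any using (here; there; index; any?)
open import Data.List.Relation.Unary.Any.Properties using (lookup-index)
open import Data.List.Relation.Unary.All as All using ([]; _∷_)
open import Data.List.Relation.Unary.All.Properties
  using (¬Any⇒All¬) renaming (++⁻ˡ to All-++⁻ˡ)
open import Data.List.Relation.Unary.AllPairs using (AllPairs; []; _∷_)
open import Data.List.Relation.Unary.Linked as Linked using (Linked; []; [-]; _∷_)
open import Data.List.Relation.Unary.Unique.Propositional using (Unique)
open import Data.List.Relation.Unary.Unique.Propositional.Properties
  using (filter⁺; allFin⁺)
open import Data.List.Membership.Propositional using (_∈_; find; lose)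
open import Data.List.Membership.Propositional.Properties
  using (∈-∃++; ∈-map⁺; ∈-filter⁺; ∈-filter⁻; ∈-allFin; ∈-lookup; ∈-length; ∈-++⁺ʳ)
import Data.List.Membership.DecPropositional as DecMembership
open import Data.List.Relation.Binary.Permutation.Propositional
  using (_↭_; ↭-refl; ↭-prep; ↭-swap; ↭-trans; ↭-sym; ↭-reflexive; ↭⇒↭ₛ)
open import Data.List.Relation.Binary.Permutation.Propositional.Properties
  using (shift; ++⁺ˡ; ↭-length; ∈-resp-↭)
import Data.List.Relation.Binary.Permutation.Setoid.Properties as Permutationₛ
open import Data.Maybe using (just)
open import Data.Empty using (⊥-elim)
open import Relation.Nullary using (¬_; Dec; yes; no; contradiction)
open import Relation.Nullary.Decidable using (_⊎-dec_; _×-dec_; ¬?; decidable-stable)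
open import Relation.Binary.PropositionalEquality
  using (_≡_; _≢_; refl; sym; trans; cong; subst; subst₂; setoid; module ≡-Reasoning)
open import Function.Base using (_∘_)
open import Function.Bundles using (_⤖_; Bijection; mk↔ₛ′)
open import Function.Definitions using (Injective)
open import Function.Construct.Composition using (_⤖-∘_)
open import Function.Construct.Symmetry using (↔-sym)
open import Function.Properties.Inverse using (↔⇒⤖)

open Bijection using (to)

module _ {A : Set} where

  data Consecutive (a b : A) : List A → Set where
    now   : ∀ {xs} → Consecutive a b (a ∷ b ∷ xs)
    later : ∀ {x xs} → Consecutive a b xs → Consecutive a b (x ∷ xs)

  Consecutive-++⁺ʳ : ∀ xs {ys} {a b : A} → Consecutive a b ys → Consecutive a b (xs ++ ys)
  Consecutive-++⁺ʳ []       c = c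
  Consecutive-++⁺ʳ (_ ∷ xs) c = later (Consecutive-++⁺ʳ xs c)

  Consecutive-insert-before : ∀ xs {x y : A} {ys a b} → Consecutive a b (xs ++ x ∷ ys) →
                              Consecutive a b (xs ++ y ∷ x ∷ ys) ⊎ b ≡ x
  Consecutive-insert-before []          now       = inj₁ (later now)
  Consecutive-insert-before []          (later c) = inj₁ (later (later c))
  Consecutive-insert-before (_ ∷ [])    now       = inj₂ refl
  Consecutive-insert-before (_ ∷ _ ∷ _) now       = inj₁ now
  Consecutive-insert-before (_ ∷ xs)    (later c) =
    Sum.map₁ later (Consecutive-insert-before xs c)

  Consecutive-insert-after : ∀ xs {x y : A} {ys a b} → Consecutive a b (xs ++ x ∷ ys) →
                             Consecutive a b (xs ++ x ∷ y ∷ ys) ⊎ (a ≡ x × ∃ λ zs → ys ≡ b ∷ zs)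
  Consecutive-insert-after []          now       = inj₂ (refl , _ , refl)
  Consecutive-insert-after []          (later c) = inj₁ (later (later c))
  Consecutive-insert-after (_ ∷ [])    now       = inj₁ now
  Consecutive-insert-after (_ ∷ _ ∷ _) now       = inj₁ now
  Consecutive-insert-after (_ ∷ xs)    (later c) =
    Sum.map₁ later (Consecutive-insert-after xs c)

  Consecutive⇒lookup : ∀ {a b : A} {xs} → Consecutive a b xs →
    ∃₂ λ (i j : Fin (length xs)) → toℕ j ≡ suc (toℕ i) × lookup xs i ≡ a × lookup xs j ≡ b
  Consecutive⇒lookup now       = zero , suc zero , refl , refl , refl
  Consecutive⇒lookup (later c) =
    let i , j , j≡1+i , i↦a , j↦b = Consecutive⇒lookup c
    in suc i , suc j , cong suc j≡1+i , i↦a , j↦b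

  lookup-injective : ∀ {xs : List A} → Unique xs → Injective _≡_ _≡_ (lookup xs)
  lookup-injective {_ ∷ _} _         {zero}  {zero}  _  = refl
  lookup-injective         (x∉ ∷ _)  {zero}  {suc j} eq =
    contradiction eq (All.lookup x∉ (∈-lookup j))
  lookup-injective         (x∉ ∷ _)  {suc i} {zero}  eq =
    contradiction (sym eq) (All.lookup x∉ (∈-lookup i))
  lookup-injective         (_ ∷ xs!) {suc i} {suc j} eq = cong suc (lookup-injective xs! eq)

  AllPairs-++⁻ˡ : ∀ {R : A → A → Set} xs {ys} → AllPairs R (xs ++ ys) → AllPairs R xs
  AllPairs-++⁻ˡ []       _          = []
  AllPairs-++⁻ˡ (_ ∷ xs) (px ∷ pxs) = All-++⁻ˡ xs px ∷ AllPairs-++⁻ˡ xs pxs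

  Linked-++⁻ˡ : ∀ {R : A → A → Set} xs {ys} → Linked R (xs ++ ys) → Linked R xs
  Linked-++⁻ˡ []           _         = []
  Linked-++⁻ˡ (_ ∷ [])     _         = [-]
  Linked-++⁻ˡ (_ ∷ y ∷ xs) (r ∷ rs)  = r ∷ Linked-++⁻ˡ (y ∷ xs) rs

  last-∷ʳ : ∀ xs {y : A} → last (xs ∷ʳ y) ≡ just y
  last-∷ʳ []           = refl
  last-∷ʳ (_ ∷ [])     = refl
  last-∷ʳ (_ ∷ x ∷ xs) = last-∷ʳ (x ∷ xs)

  ∈⇒↭∷ : ∀ {x : A} {xs} → x ∈ xs → ∃ λ ys → xs ↭ x ∷ ys
  ∈⇒↭∷ {x} x∈xs =
    let ys , zs , xs≡ = ∈-∃++ x∈xs in ys ++ zs , ↭-trans (↭-reflexive xs≡) (shift x ys zs)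

  twoDistinctMembers : ∀ {xs : List A} → 2 ≤ length xs → Unique xs →
                       ∃₂ λ x y → x ∈ xs × y ∈ xs × x ≢ y
  twoDistinctMembers {_ ∷ []}    (s≤s ()) _
  twoDistinctMembers {x ∷ y ∷ _} _        ((x≢y ∷ _) ∷ _) =
    x , y , here refl , there (here refl) , x≢y

Unique⇒length≤ : ∀ {k} {xs : List (Fin k)} → Unique xs → length xs ≤ k
Unique⇒length≤ xs! = injective⇒≤ (lookup-injective xs!)

Successive : ∀ {A : Set} {k} → (A → Fin k) → A → A → Set
Successive ν a b = toℕ (ν b) ≡ suc (toℕ (ν a))

module Enumeration {A : Set} {xs : List A} (xs! : Unique xs) (complete : ∀ x → x ∈ xs) where

  position : A → Fin (length xs)
  position x = index (complete x)

  lookup-position : ∀ x → lookup xs (position x) ≡ x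
  lookup-position x = sym (lookup-index (complete x))

  position-lookup : ∀ i → position (lookup xs i) ≡ i
  position-lookup i = lookup-injective xs! (lookup-position (lookup xs i))

  position-Consecutive : ∀ {a b} → Consecutive a b xs → Successive position a b
  position-Consecutive c with i , j , j≡1+i , refl , refl ← Consecutive⇒lookup c
    rewrite position-lookup i | position-lookup j = j≡1+i

  numbering : ∀ {k} → length xs ≡ k →
              Σ (A ⤖ Fin k) λ ν → ∀ {a b} → Consecutive a b xs → Successive (to ν) a b
  numbering refl =
    ↔⇒⤖ (mk↔ₛ′ position (lookup xs) position-lookup lookup-position) , position-Consecutive

↭allFin⇒numbering : ∀ {k} {S : List (Fin k)} → S ↭ allFin k →
                    Σ (Fin k ⤖ Fin k) λ ν → ∀ {a b} → Consecutive a b S → Successive (to ν) a b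
↭allFin⇒numbering {k} {S} S↭ =
  Enumeration.numbering S! complete (trans (↭-length S↭) (length-tabulate _))
  where
  S! : Unique S
  S! = Permutationₛ.Unique-resp-↭ (setoid (Fin k)) (↭⇒↭ₛ (↭-sym S↭)) (allFin⁺ k)
  complete : ∀ i → i ∈ S
  complete i = ∈-resp-↭ (↭-sym S↭) (∈-allFin i)

module _ (G : Graph) where

  private
    V = Fin (n G)
    E = Fin (m G)

  Joins : E → V → V → Set
  Joins e x y = ends G e ≡ (x , y) ⊎ ends G e ≡ (y , x)

  Joins-sym : ∀ {e x y} → Joins e x y → Joins e y x
  Joins-sym = Sum.swap

  Joins⇒Incident : ∀ {e x y} → Joins e x y → Incident G e x
  Joins⇒Incident (inj₁ eq) = inj₁ (cong proj₁ eq)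
  Joins⇒Incident (inj₂ eq) = inj₂ (cong proj₂ eq)

  Incident⇒Joins : ∀ {e x} → Incident G e x → ∃ (Joins e x)
  Incident⇒Joins (inj₁ refl) = _ , inj₁ refl
  Incident⇒Joins (inj₂ refl) = _ , inj₂ refl

  Incident⇒endpoint : ∀ {e x y z} → Joins e x y → Incident G e z → z ≡ x ⊎ z ≡ y
  Incident⇒endpoint (inj₁ eq) (inj₁ p) = inj₁ (trans (sym p) (cong proj₁ eq))
  Incident⇒endpoint (inj₁ eq) (inj₂ p) = inj₂ (trans (sym p) (cong proj₂ eq))
  Incident⇒endpoint (inj₂ eq) (inj₁ p) = inj₂ (trans (sym p) (cong proj₁ eq))
  Incident⇒endpoint (inj₂ eq) (inj₂ p) = inj₁ (trans (sym p) (cong proj₂ eq))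

  Joins-irrefl : ∀ {e x y} → Joins e x y → x ≢ y
  Joins-irrefl {e} x~x refl =
    let eq = reduce x~x in noLoop G e (trans (cong proj₁ eq) (sym (cong proj₂ eq)))

  Joins-unique : ∀ {e e' x y} → Joins e x y → Joins e' x y → e ≡ e'
  Joins-unique {e} {e'} (inj₁ eq) (inj₁ eq') = noMulti G e e' (inj₁ (trans eq (sym eq')))
  Joins-unique {e} {e'} (inj₁ eq) (inj₂ eq') = noMulti G e e' (inj₂ (trans eq (cong swap (sym eq'))))
  Joins-unique {e} {e'} (inj₂ eq) (inj₁ eq') = noMulti G e e' (inj₂ (trans eq (cong swap (sym eq'))))
  Joins-unique {e} {e'} (inj₂ eq) (inj₂ eq') = noMulti G e e' (inj₁ (trans eq (sym eq')))

  incident? : ∀ e v → Dec (Incident G e v)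
  incident? e v = (proj₁ (ends G e) ≟ v) ⊎-dec (proj₂ (ends G e) ≟ v)

  chordCycle : ∀ {x x' y rest} → Unique (x ∷ x' ∷ rest) → Linked (Adj G) (x ∷ x' ∷ rest) →
               y ∈ rest → Adj G y x → Cycle G
  chordCycle {x} {x'} {y} path! path y∈rest y~x with R₁ , R₂ , refl ← ∈-∃++ y∈rest = record
    { verts    = x ∷ x' ∷ R₁ ∷ʳ y
    ; long     = s≤s (s≤s (∈-length (∈-++⁺ʳ R₁ (here refl))))
    ; distinct = AllPairs-++⁻ˡ (x ∷ x' ∷ R₁ ∷ʳ y) (subst Unique split path!)
    ; steps    = Linked-++⁻ˡ (x ∷ x' ∷ R₁ ∷ʳ y) (subst (Linked (Adj G)) split path)
    ; first    = x
    ; lastV    = y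
    ; isFirst  = refl
    ; isLast   = last-∷ʳ (x ∷ x' ∷ R₁)
    ; closes   = y~x
    }
    where
    split : x ∷ x' ∷ R₁ ++ [ y ] ++ R₂ ≡ (x ∷ x' ∷ R₁ ∷ʳ y) ++ R₂
    split = cong (λ r → x ∷ x' ∷ r) (sym (++-assoc R₁ [ y ] R₂))

  PendantIn : List E → E → V → Set
  PendantIn L e v = e ∈ L × Incident G e v × (∀ {e'} → e' ∈ L → Incident G e' v → e' ≡ e)

  module _ (acyclic : Acyclic G) (L : List E) where
    open DecMembership (_≟_ {n G}) using (_∈?_)

    AdjacentIn : V → V → Set
    AdjacentIn x y = ∃ λ e → e ∈ L × Joins e x y

    extendPath : ∀ fuel {x x' rest} →
                 Unique (x ∷ x' ∷ rest) → Linked AdjacentIn (x ∷ x' ∷ rest) →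
                 n G < fuel + length (x ∷ x' ∷ rest) → ∃₂ (PendantIn L)
    extendPath zero path! _ long = contradiction (Unique⇒length≤ path!) (<⇒≱ long)
    extendPath (suc fuel) {x} {x'} {rest} path! path long
      with e₀ , e₀∈L , x~x' ← Linked.head path
      with any? (λ e → ¬? (e ≟ e₀) ×-dec incident? e x) L
    ... | no noOther =
      e₀ , x , e₀∈L , Joins⇒Incident x~x' ,
      λ e∈L e~x → decidable-stable (_ ≟ e₀) (λ e≢e₀ → noOther (lose e∈L (e≢e₀ , e~x)))
    ... | yes other
      with e , e∈L , e≢e₀ , e~x ← find other
      with y , x~y ← Incident⇒Joins e~x
      with y ∈? (x ∷ x' ∷ rest)
    ... | no y∉path =
      extendPath fuel (¬Any⇒All¬ _ y∉path ∷ path!) ((e , e∈L , Joins-sym x~y) ∷ path)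
        (subst (n G <_) (sym (+-suc fuel _)) long)
    ... | yes (here y≡x)              = contradiction (sym y≡x) (Joins-irrefl x~y)
    ... | yes (there (here refl))     = contradiction (Joins-unique x~y x~x') e≢e₀
    ... | yes (there (there y∈rest))  =
      ⊥-elim (acyclic (chordCycle path! (Linked.map forget path) y∈rest (e , Joins-sym x~y)))
      where
      forget : ∀ {u v} → AdjacentIn u v → Adj G u v
      forget (e , _ , u~v) = e , u~v

    pendant : ∀ {e} → e ∈ L → ∃₂ (PendantIn L)
    pendant {e} e∈L =
      extendPath (n G) ((Joins-irrefl e~ ∷ []) ∷ [] ∷ []) ((e , e∈L , e~) ∷ [-])
        (m<m+n (n G) (s≤s z≤n))
      where
      e~ : Joins e (proj₁ (ends G e)) (proj₂ (ends G e))
      e~ = inj₁ refl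

  ConsecutiveAt : List E → V → Set
  ConsecutiveAt S z = ∃₂ λ a b → Consecutive a b S × Incident G a z × Incident G b z

  Branching : List E → V → Set
  Branching L z =
    ∃₂ λ e₁ e₂ → e₁ ∈ L × e₂ ∈ L × e₁ ≢ e₂ × Incident G e₁ z × Incident G e₂ z

  ConsecutiveOrdering : List E → List E → Set
  ConsecutiveOrdering L S = S ↭ L × (∀ {z} → Branching L z → ConsecutiveAt S z)

  Extends : E → List E → List E → Set
  Extends e S' S = S ↭ e ∷ S' × (∀ {z} → ConsecutiveAt S' z → ConsecutiveAt S z)

  module _ {e e' u w} (P : List E) (e~u : Incident G e u) (u~w : Joins e' u w) where

    insertBefore : ∀ {y Q} → Incident G y w →
                   Extends e (P ++ e' ∷ y ∷ Q) (P ++ e ∷ e' ∷ y ∷ Q) ×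
                   ConsecutiveAt (P ++ e ∷ e' ∷ y ∷ Q) u
    insertBefore {y} {Q} y~w = (shift e P (e' ∷ y ∷ Q) , keep) , at-u
      where
      at-u : ConsecutiveAt (P ++ e ∷ e' ∷ y ∷ Q) u
      at-u = e , e' , Consecutive-++⁺ʳ P now , e~u , Joins⇒Incident u~w

      keep : ∀ {z} → ConsecutiveAt (P ++ e' ∷ y ∷ Q) z → ConsecutiveAt (P ++ e ∷ e' ∷ y ∷ Q) z
      keep (a , b , c , a~z , b~z) with Consecutive-insert-before P c
      ... | inj₁ c' = a , b , c' , a~z , b~z
      ... | inj₂ refl with Incident⇒endpoint u~w b~z
      ...   | inj₁ refl = at-u
      ...   | inj₂ refl = e' , y , Consecutive-++⁺ʳ P (later now) , b~z , y~w

    insertAfter : ∀ {Q} → (∀ {y Q'} → Q ≡ y ∷ Q' → ¬ Incident G y w) →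
                  Extends e (P ++ e' ∷ Q) (P ++ e' ∷ e ∷ Q) × ConsecutiveAt (P ++ e' ∷ e ∷ Q) u
    insertAfter {Q} next≁w =
      (↭-trans (++⁺ˡ P (↭-swap e' e ↭-refl)) (shift e P (e' ∷ Q)) , keep) , at-u
      where
      at-u : ConsecutiveAt (P ++ e' ∷ e ∷ Q) u
      at-u = e' , e , Consecutive-++⁺ʳ P now , Joins⇒Incident u~w , e~u

      keep : ∀ {z} → ConsecutiveAt (P ++ e' ∷ Q) z → ConsecutiveAt (P ++ e' ∷ e ∷ Q) z
      keep (a , b , c , a~z , b~z) with Consecutive-insert-after P c
      ... | inj₁ c' = a , b , c' , a~z , b~z
      ... | inj₂ (refl , _ , Q≡) with Incident⇒endpoint u~w a~z
      ...   | inj₁ refl = at-u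
      ...   | inj₂ refl = contradiction b~z (next≁w Q≡)

    insertNextTo : ∀ Q → ∃ λ S → Extends e (P ++ e' ∷ Q) S × ConsecutiveAt S u
    insertNextTo []      = _ , insertAfter λ ()
    insertNextTo (y ∷ Q) with incident? y w
    ... | yes y~w = _ , insertBefore y~w
    ... | no  y≁w = _ , insertAfter λ { refl → y≁w }

  insertEdge : ∀ {e u} S' → Incident G e u →
               ∃ λ S → Extends e S' S × (∀ {e'} → e' ∈ S' → Incident G e' u → ConsecutiveAt S u)
  insertEdge {e} {u} S' e~u with any? (λ e' → incident? e' u) S'
  ... | no none =
    e ∷ S' , (↭-refl , λ (a , b , c , a~z , b~z) → a , b , later c , a~z , b~z) ,
    λ e'∈S' e'~u → contradiction (lose e'∈S' e'~u) none
  ... | yes some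
    with e' , e'∈S' , e'~u ← find some
    with P , Q , refl ← ∈-∃++ e'∈S'
    with w , u~w ← Incident⇒Joins e'~u
    with S , extends , at-u ← insertNextTo P e~u u~w Q
    = S , extends , λ _ _ → at-u

  addPendant : ∀ {L L' e v S'} → L ↭ e ∷ L' → PendantIn L e v →
               ConsecutiveOrdering L' S' → ∃ (ConsecutiveOrdering L)
  addPendant {L} {L'} {e} {S' = S'} L↭ (_ , e~v , onlyE) (S'↭L' , ordered')
    with u , v~u ← Incident⇒Joins e~v
    with S , (S↭ , keep) , at-u ← insertEdge S' (Joins⇒Incident (Joins-sym v~u))
    = S , ↭-trans S↭ (↭-trans (↭-prep e S'↭L') (↭-sym L↭)) , ordered
    where
    atNewEdge : ∀ {e' z} → e' ∈ L → e' ∈ L' → e' ≢ e →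
                Incident G e z → Incident G e' z → ConsecutiveAt S z
    atNewEdge e'∈L e'∈L' e'≢e e~z e'~z with Incident⇒endpoint v~u e~z
    ... | inj₁ refl = contradiction (onlyE e'∈L e'~z) e'≢e
    ... | inj₂ refl = at-u (∈-resp-↭ (↭-sym S'↭L') e'∈L') e'~z

    ordered : ∀ {z} → Branching L z → ConsecutiveAt S z
    ordered (e₁ , e₂ , e₁∈L , e₂∈L , e₁≢e₂ , e₁~z , e₂~z)
      with ∈-resp-↭ L↭ e₁∈L | ∈-resp-↭ L↭ e₂∈L
    ... | here refl   | here refl   = contradiction refl e₁≢e₂
    ... | here refl   | there e₂∈L' = atNewEdge e₂∈L e₂∈L' (e₁≢e₂ ∘ sym) e₁~z e₂~z
    ... | there e₁∈L' | here refl   = atNewEdge e₁∈L e₁∈L' e₁≢e₂ e₂~z e₁~z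
    ... | there e₁∈L' | there e₂∈L' =
      keep (ordered' (e₁ , e₂ , e₁∈L' , e₂∈L' , e₁≢e₂ , e₁~z , e₂~z))

  consecutiveOrdering : Acyclic G → ∀ L → ∃ (ConsecutiveOrdering L)
  consecutiveOrdering acyclic L = byLength _ L refl
    where
    byLength : ∀ k L → length L ≡ k → ∃ (ConsecutiveOrdering L)
    byLength _       []        _   = [] , ↭-refl , λ { (_ , _ , () , _) }
    byLength (suc k) L@(_ ∷ _) len =
      let _ , _ , pendantEdge = pendant acyclic L (here refl)
          L' , L↭ = ∈⇒↭∷ (proj₁ pendantEdge)
          L'-length = suc-injective (trans (sym (↭-length L↭)) len)
      in addPendant L↭ pendantEdge (proj₂ (byLength k L' L'-length))

  degree≥2⇒Branching : ∀ {v} → 2 ≤ degree G v → Branching (allFin (m G)) v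
  degree≥2⇒Branching {v} deg≥2 =
    let e₁ , e₂ , e₁∈ , e₂∈ , e₁≢e₂ =
          twoDistinctMembers deg≥2 (filter⁺ (λ e → incident? e v) (allFin⁺ (m G)))
    in e₁ , e₂ , ∈-allFin e₁ , ∈-allFin e₂ , e₁≢e₂ , incident e₁∈ , incident e₂∈
    where
    incident : ∀ {e} → e ∈ incidentEdges G v → Incident G e v
    incident e∈ = proj₂ (∈-filter⁻ (λ e → incident? e v) {xs = allFin (m G)} e∈)

  SuccessiveEdgesAt : (Fin (m G) → Fin (m G)) → V → Set
  SuccessiveEdgesAt ν v = ∃₂ λ a b → Incident G a v × Incident G b v × Successive ν a b

  edgeNumbering : Acyclic G →
                  Σ (E ⤖ Fin (m G)) λ ν → ∀ v → 2 ≤ degree G v → SuccessiveEdgesAt (to ν) v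
  edgeNumbering acyclic =
    let S , S↭ , ordered = consecutiveOrdering acyclic (allFin (m G))
        ν , successive = ↭allFin⇒numbering S↭
    in ν , λ v deg≥2 → let a , b , c , a~v , b~v = ordered (degree≥2⇒Branching deg≥2)
                       in a , b , a~v , b~v , successive c

foldr-gcd-∣ : ∀ {x} xs → x ∈ xs → foldr gcd 0 xs ∣ x
foldr-gcd-∣ (y ∷ ys) (here refl) = gcd[m,n]∣m y (foldr gcd 0 ys)
foldr-gcd-∣ (y ∷ ys) (there x∈)  = ∣-trans (gcd[m,n]∣n y _) (foldr-gcd-∣ ys x∈)

∣-consecutive⇒≡1 : ∀ {d k} → d ∣ k → d ∣ suc k → d ≡ 1
∣-consecutive⇒≡1 {d} {k} d∣k d∣1+k =
  ∣1⇒≡1 (∣m+n∣m⇒∣n (subst (d ∣_) (+-comm 1 k) d∣1+k) d∣k)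

module _ (G : Graph) (f : Fin (n G) ⤖ Fin (n G)) (ν : Fin (m G) ⤖ Fin (m G)) where

  totalLabelling : (Fin (n G) ⊎ Fin (m G)) ⤖ Fin (n G + m G)
  totalLabelling = ↔⇒⤖ (↔-sym +↔⊎) ⤖-∘ (f ⊎-⤖ ν)

  private
    ℓV = labelV G totalLabelling
    ℓE = labelE G totalLabelling

  labelV-totalLabelling : ∀ v → ℓV v ≡ suc (toℕ (to f v))
  labelV-totalLabelling v = cong suc (toℕ-↑ˡ (to f v) (m G))

  labelE-totalLabelling : ∀ e → ℓE e ≡ suc (n G + toℕ (to ν e))
  labelE-totalLabelling e = cong suc (toℕ-↑ʳ (n G) (to ν e))

  labelE-Successive : ∀ {a b} → Successive (to ν) a b → ℓE b ≡ suc (ℓE a)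
  labelE-Successive {a} {b} successive = begin
    ℓE b                           ≡⟨ labelE-totalLabelling b ⟩
    suc (n G + toℕ (to ν b))       ≡⟨ cong (λ i → suc (n G + i)) successive ⟩
    suc (n G + suc (toℕ (to ν a))) ≡⟨ cong suc (+-suc (n G) _) ⟩
    suc (suc (n G + toℕ (to ν a))) ≡⟨ cong suc (labelE-totalLabelling a) ⟨
    suc (ℓE a)                     ∎
    where open ≡-Reasoning

  incidentGcd-∣-labelE : ∀ {v e} → Incident G e v → incidentGcd G totalLabelling v ∣ ℓE e
  incidentGcd-∣-labelE {v} e~v =
    foldr-gcd-∣ _ (∈-map⁺ ℓE (∈-filter⁺ (λ e → incident? G e v) (∈-allFin _) e~v))

  totalLabelling-isTotalPrime : IsPrimeLabeling G f →
                                (∀ v → 2 ≤ degree G v → SuccessiveEdgesAt G (to ν) v) →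
                                IsTotalPrimeLabeling G totalLabelling
  totalLabelling-isTotalPrime prime successiveAt = coprime , incidentGcd≡1
    where
    coprime : ∀ u v → Adj G u v → Coprime (ℓV u) (ℓV v)
    coprime u v u~v =
      subst₂ Coprime (sym (labelV-totalLabelling u)) (sym (labelV-totalLabelling v)) (prime u v u~v)

    incidentGcd≡1 : ∀ v → 2 ≤ degree G v → incidentGcd G totalLabelling v ≡ 1
    incidentGcd≡1 v deg≥2 =
      let a , b , a~v , b~v , successive = successiveAt v deg≥2
      in ∣-consecutive⇒≡1 (incidentGcd-∣-labelE a~v)
           (subst (incidentGcd G totalLabelling v ∣_) (labelE-Successive successive)
             (incidentGcd-∣-labelE b~v))

mainTheorem16 : (G : Graph) → IsTree G → IsPrime G → IsTotalPrime G
mainTheorem16 G (_ , _ , acyclic) (f , prime) =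
  let ν , successiveAt = edgeNumbering G acyclic
  in totalLabelling G f ν , totalLabelling-isTotalPrime G f ν prime successiveAt
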